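{- Let $\mathcal{F}$ be a (possibly infinite) signature with only finitely many AC symbols, and let $>$ be a well-founded precedence on $\mathcal{F}$ in which all AC symbols are minimal. Then $>_{\mathrm{acmpo}}$ is an AC-compatible reduction order.
   Context: $\mathcal{F}$ is a signature of function symbols with arities, $\mathcal{V}$ a countably infinite set of variables, and $\mathcal{F}_{\mathrm{AC}}\subseteq\mathcal{F}$ the set of AC symbols (binary); $=_{\mathrm{AC}}$ is the congruence generated by $f(f(x,y),z)\approx f(x,f(y,z))$ and $f(x,y)\approx f(y,x)$ for $f\in\mathcal{F}_{\mathrm{AC}}$. $\mathrm{root}(t)$ is $t$ if $t$ is a variable and $f$ if $t=f(t_1,\dots,t_n)$. For non-variable $t=f(t_1,\dots,t_n)$, $\mathrm{TF}(t)=\mathrm{TF}_f(t_1)\uplus\cdots\uplus\mathrm{TF}_f(t_n)$, where $\mathrm{TF}_f(u)=\mathrm{TF}_f(u_1)\uplus\mathrm{TF}_f(u_2)$ if $u=f(u_1,u_2)$ with $f\in\mathcal{F}_{\mathrm{AC}}$, and $\mathrm{TF}_f(u)=\{u\}$ otherwise. $=_{\mathrm{AC}}^{\mathrm{mul}}$: $\varnothing=_{\mathrm{AC}}^{\mathrm{mul}}\varnothing$, and $\{s\}\uplus M=_{\mathrm{AC}}^{\mathrm{mul}}\{t\}\uplus N$ if $s=_{\mathrm{AC}}t$ and $M=_{\mathrm{AC}}^{\mathrm{mul}}N$. A precedence is a strict order $>$ on $\mathcal{F}$; an AC symbol $f$ is minimal if there is no $g$ with $f>g$. $s>_{\mathrm{acmpo}}t$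 iff $s\notin\mathcal{V}$ and one of: (1) some $s'\in\mathrm{TF}(s)$ has $s'>_{\mathrm{acmpo}}t$ or $s'=_{\mathrm{AC}}t$; (2) $\mathrm{root}(s)>\mathrm{root}(t)$ and $s>_{\mathrm{acmpo}}t'$ for all $t'\in\mathrm{TF}(t)$; (3) $\mathrm{root}(s)=\mathrm{root}(t)$ and there are multisets with $\mathrm{TF}(s)=S_1\uplus S_2$, $\mathrm{TF}(t)=T_1\uplus T_2$, $S_1=_{\mathrm{AC}}^{\mathrm{mul}}T_1$, $S_2\ne\varnothing$, and each $t'\in T_2$ has some $s'\in S_2$ with $s'>_{\mathrm{acmpo}}t'$. A reduction order is a well-founded strict order on terms closed under contexts and substitutions; it is AC-compatible if ${=_{\mathrm{AC}}}\cdot{>}\cdot{=_{\mathrm{AC}}}\subseteq{>}$. -}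

module Defs where

open import Level using (0ℓ)
open import Data.Nat using (ℕ)
open import Data.Fin using (Fin; _≟_)
open import Data.Sum using (_⊎_; inj₁; inj₂)
open import Data.Product using (∃; _×_)
open import Data.Unit using (⊤)
open import Data.Empty using (⊥)
open import Data.List using (List; []; _∷_; _++_; [_])
open import Data.Vec as Vec using (Vec; toList; _[_]≔_)
import Data.Vec.Relation.Binary.Pointwise.Inductive as VP
import Data.List.Relation.Binary.Pointwise as LP
open import Data.List.Relation.Unary.All using (All)
open import Data.List.Relation.Unary.Any using (Any)
open import Data.List.Membership.Propositional using (_∈_)
open import Data.List.Relation.Binary.Permutation.Propositional using (_↭_)
open import Relation.Nullary using (¬_; yes; no)
open import Relation.Binary.PropositionalEquality using (_≡_; _≢_)
open import Relation.Binary.Structures using (IsStrictPartialOrder)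
open import Induction.WellFounded using (WellFounded)
open import Function using (flip)

-- A signature: an arbitrary (possibly infinite) type N of non-AC function
-- symbols with arities, together with finitely many (k) AC symbols, which
-- are binary.
module _ (N : Set) (arity : N → ℕ) (k : ℕ) where

  Sym : Set
  Sym = N ⊎ Fin k

  data Term : Set where
    var : ℕ → Term
    fun : (f : N) → Vec Term (arity f) → Term
    ac  : (f : Fin k) → Term → Term → Term

  root : Term → ℕ ⊎ Sym
  root (var x)    = inj₁ x
  root (fun f _)  = inj₂ (inj₁ f)
  root (ac f _ _) = inj₂ (inj₂ f)

  NonVar : Term → Set
  NonVar (var _) = ⊥
  NonVar (fun _ _) = ⊤
  NonVar (ac _ _ _) = ⊤

  data _=AC_ : Term → Term → Set where
    ac-refl  : ∀ {s} → s =AC s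
    ac-sym   : ∀ {s t} → s =AC t → t =AC s
    ac-trans : ∀ {s t u} → s =AC t → t =AC u → s =AC u
    ac-cong-fun : ∀ f {ts us} → VP.Pointwise _=AC_ ts us → fun f ts =AC fun f us
    ac-cong-ac  : ∀ f {u u' v v'} → u =AC u' → v =AC v' → ac f u v =AC ac f u' v'
    ac-assoc : ∀ f x y z → ac f (ac f x y) z =AC ac f x (ac f y z)
    ac-comm  : ∀ f x y → ac f x y =AC ac f y x

  -- TF_f(u) for an AC symbol f (for non-AC f, TF_f(u) = {u})
  TFf : Fin k → Term → List Term
  TFf f (ac g u v) with f ≟ g
  ... | yes _ = TFf f u ++ TFf f v
  ... | no _  = [ ac g u v ]
  TFf f t = [ t ]

  -- TF(t), only meaningful for non-variable t (variables are never queried)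
  TF : Term → List Term
  TF (var _)    = []
  TF (fun f ts) = toList ts
  TF (ac f u v) = TFf f u ++ TFf f v

  -- multiset equality modulo AC (lists compared pointwise; multiset
  -- decompositions are expressed via permutations below)
  _=ACmul_ : List Term → List Term → Set
  _=ACmul_ = LP.Pointwise _=AC_

  module _ (_>_ : Sym → Sym → Set) where

    data _>acmpo_ : Term → Term → Set where
      acmpo1 : ∀ {s t s'} → NonVar s → s' ∈ TF s → (s' >acmpo t ⊎ s' =AC t)
             → s >acmpo t
      acmpo2 : ∀ {s t f g} → root s ≡ inj₂ f → root t ≡ inj₂ g → f > g
             → All (s >acmpo_) (TF t) → s >acmpo t
      acmpo3 : ∀ {s t} (S₁ S₂ T₁ T₂ : List Term) → NonVar s → root s ≡ root t
             → TF s ↭ (S₁ ++ S₂) → TF t ↭ (T₁ ++ T₂)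
             → S₁ =ACmul T₁ → S₂ ≢ []
             → All (λ t' → Any (λ s' → s' >acmpo t') S₂) T₂
             → s >acmpo t

  ACMinimal : (Sym → Sym → Set) → Set
  ACMinimal _>_ = ∀ (f : Fin k) (g : Sym) → ¬ (inj₂ f > g)

  Subst : Set
  Subst = ℕ → Term

  mutual
    _⟨_⟩ : Term → Subst → Term
    var x ⟨ σ ⟩    = σ x
    fun f ts ⟨ σ ⟩ = fun f (substs ts σ)
    ac f u v ⟨ σ ⟩ = ac f (u ⟨ σ ⟩) (v ⟨ σ ⟩)

    substs : ∀ {n} → Vec Term n → Subst → Vec Term n
    substs Vec.[] σ = Vec.[]
    substs (t Vec.∷ ts) σ = (t ⟨ σ ⟩) Vec.∷ substs ts σ

  data Ctx : Set where
    □    : Ctx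
    funC : (f : N) → Vec Term (arity f) → Fin (arity f) → Ctx → Ctx
    acL  : Fin k → Ctx → Term → Ctx
    acR  : Fin k → Term → Ctx → Ctx

  _⟦_⟧ : Ctx → Term → Term
  □ ⟦ t ⟧ = t
  funC f ts i C ⟦ t ⟧ = fun f (ts [ i ]≔ (C ⟦ t ⟧))
  acL f C u ⟦ t ⟧ = ac f (C ⟦ t ⟧) u
  acR f u C ⟦ t ⟧ = ac f u (C ⟦ t ⟧)

  record IsReductionOrder (_≻_ : Term → Term → Set) : Set where
    field
      isStrictPartialOrder : IsStrictPartialOrder _≡_ _≻_
      wellFounded          : WellFounded (flip _≻_)
      closedUnderContexts  : ∀ (C : Ctx) {s t} → s ≻ t → (C ⟦ s ⟧) ≻ (C ⟦ t ⟧)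
      closedUnderSubst     : ∀ (σ : Subst) {s t} → s ≻ t → (s ⟨ σ ⟩) ≻ (t ⟨ σ ⟩)

  ACCompatible : (Term → Term → Set) → Set
  ACCompatible _≻_ = ∀ {s s' t' t} → s =AC s' → s' ≻ t' → t' =AC t → s ≻ t

-- Everything is phrased through the flattened arguments TF t, which =AC changes
-- only up to a permutation and elementwise =AC, so that the third clause of the
-- AC-MPO is the multiset extension of the order modulo =AC. For well-foundedness one inducts on the root symbol along the
-- precedence and, for a fixed root, on the flattened arguments in the
-- Dershowitz–Manna multiset order, which is well-founded on multisets of
-- accessible terms. Minimality of the AC symbols is needed only for closure under
-- contexts: an f-rooted s is never above t by precedence, so s > t always lifts
-- to TF_f(s) > TF_f(t) in the multiset extension, whence f(s, u) > f(t, u).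

module Submission where

open import Defs
open import Data.Nat using (ℕ)
open import Data.Fin using (Fin; _≟_; zero; suc)
open import Data.Vec as Vec using (Vec; toList; _[_]≔_)
import Data.Vec.Relation.Binary.Pointwise.Inductive as VecPointwise
open import Data.List using (List; []; _∷_; _++_; [_]; concat; concatMap; map)
import Data.List.Properties as List
import Data.List.Relation.Binary.Pointwise as Pointwise
open Pointwise using (Pointwise; []; _∷_)
open import Data.List.Relation.Binary.Permutation.Propositional
open import Data.List.Relation.Binary.Permutation.Propositional.Properties
open import Data.List.Membership.Propositional using (_∈_; find; lose)
open import Data.List.Membership.Propositional.Properties
  using (∈-∃++; ∈-++⁻; ∈-++⁺ˡ; ∈-++⁺ʳ; ∈-concatMap⁺; ∈-concatMap⁻)
open import Data.List.Relation.Unary.Any using (Any; here; there)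
open import Data.List.Relation.Unary.All as All using (All; []; _∷_)
import Data.List.Relation.Unary.All.Properties as All
open import Data.Product using (∃; ∃₂; _×_; _,_; proj₂)
open import Data.Sum using (_⊎_; inj₁; inj₂)
open import Data.Sum.Properties using (inj₂-injective)
open import Data.Empty using (⊥-elim)
open import Data.Unit using (tt)
open import Relation.Nullary using (¬_; yes; no)
open import Relation.Binary.PropositionalEquality
  using (_≡_; _≢_; refl; sym; cong; subst; subst₂; isEquivalence; resp₂) renaming (trans to ≡-trans)
open import Relation.Binary.Structures using (IsEquivalence; IsStrictPartialOrder)
open import Relation.Binary.Construct.Closure.Transitive as Plus using (TransClosure; _∷ʳ_)
open import Induction.WellFounded using (WellFounded; Acc; acc; acc-inverse; wf⇒asym)
open import Function using (flip; _∘_; case_of_)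

module _ {A : Set} where

  ∈⇒↭∷ : ∀ {x : A} {xs} → x ∈ xs → ∃ λ ys → xs ↭ x ∷ ys
  ∈⇒↭∷ {x} x∈xs with ys , zs , refl ← ∈-∃++ x∈xs = ys ++ zs , shift x ys zs

  ∈⇒≢[] : ∀ {x : A} {xs} → x ∈ xs → xs ≢ []
  ∈⇒≢[] x∈ refl with () ← x∈

  ++-≢[]ʳ : ∀ (xs : List A) {ys} → ys ≢ [] → xs ++ ys ≢ []
  ++-≢[]ʳ xs ys≢[] = ys≢[] ∘ List.++-conicalʳ xs _

  ++↭++-refine : ∀ (xs ys zs ws : List A) → xs ++ ys ↭ zs ++ ws →
    ∃₂ λ a b → ∃₂ λ c d →
      (xs ↭ a ++ b) × (ys ↭ c ++ d) × (zs ↭ a ++ c) × (ws ↭ b ++ d)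
  ++↭++-refine [] ys zs ws p = [] , [] , zs , ws , ↭-refl , p , ↭-refl , ↭-refl
  ++↭++-refine (x ∷ xs) ys zs ws p with ∈-++⁻ zs (∈-resp-↭ p (here refl))
  ... | inj₁ x∈zs with zs′ , zs↭ ← ∈⇒↭∷ x∈zs
    with a , b , c , d , p₁ , p₂ , p₃ , p₄
           ← ++↭++-refine xs ys zs′ ws (drop-∷ (↭-trans p (++⁺ʳ ws zs↭)))
    = x ∷ a , b , c , d , prep x p₁ , p₂ , ↭-trans zs↭ (prep x p₃) , p₄
  ... | inj₂ x∈ws with ws′ , ws↭ ← ∈⇒↭∷ x∈ws
    with a , b , c , d , p₁ , p₂ , p₃ , p₄
           ← ++↭++-refine xs ys zs ws′
               (drop-∷ (↭-trans p (↭-trans (++⁺ˡ zs ws↭) (shift x zs ws′))))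
    = a , x ∷ b , c , d , ↭-trans (prep x p₁) (↭-sym (shift x a b)) , p₂ , p₃
    , ↭-trans ws↭ (prep x p₄)

  toList-[]≔ : ∀ {n} (xs : Vec A n) i → ∃₂ λ ys zs → ∀ x → toList (xs [ i ]≔ x) ≡ ys ++ x ∷ zs
  toList-[]≔ (x Vec.∷ xs) zero = [] , toList xs , λ _ → refl
  toList-[]≔ (x Vec.∷ xs) (suc i) with ys , zs , eq ← toList-[]≔ xs i =
    x ∷ ys , zs , cong (x ∷_) ∘ eq

  concatMap-++ : ∀ {B : Set} (F : A → List B) xs ys →
    concatMap F (xs ++ ys) ≡ concatMap F xs ++ concatMap F ys
  concatMap-++ F xs ys =
    ≡-trans (cong concat (List.map-++ F xs ys)) (sym (List.concat-++ (map F xs) _))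

  concatMap-↭ : ∀ {B : Set} (F : A → List B) {xs ys} → xs ↭ ys → concatMap F xs ↭ concatMap F ys
  concatMap-↭ F refl = ↭-refl
  concatMap-↭ F (prep x p) = ++⁺ˡ (F x) (concatMap-↭ F p)
  concatMap-↭ F (swap x y p) =
    ↭-trans (shifts (F x) (F y)) (++⁺ˡ (F y) (++⁺ˡ (F x) (concatMap-↭ F p)))
  concatMap-↭ F (trans p q) = ↭-trans (concatMap-↭ F p) (concatMap-↭ F q)

  concatMap-≢[] : ∀ {B : Set} (F : A → List B) → (∀ x → F x ≢ []) →
    ∀ {xs} → xs ≢ [] → concatMap F xs ≢ []
  concatMap-≢[] F F≢[] {[]} xs≢[] _ = xs≢[] refl
  concatMap-≢[] F F≢[] {x ∷ xs} _ = F≢[] x ∘ List.++-conicalˡ (F x) _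

module _ {A B : Set} {R : A → B → Set} where

  Pointwise-↭ : ∀ {xs ys zs} → Pointwise R xs ys → ys ↭ zs →
    ∃ λ xs′ → xs ↭ xs′ × Pointwise R xs′ zs
  Pointwise-↭ rs refl = _ , ↭-refl , rs
  Pointwise-↭ (r ∷ rs) (prep _ p) with _ , p′ , rs′ ← Pointwise-↭ rs p =
    _ , prep _ p′ , r ∷ rs′
  Pointwise-↭ (r ∷ r′ ∷ rs) (swap _ _ p) with _ , p′ , rs′ ← Pointwise-↭ rs p =
    _ , swap _ _ p′ , r′ ∷ r ∷ rs′
  Pointwise-↭ rs (trans p q)
    with _ , p′ , rs′ ← Pointwise-↭ rs p
    with _ , q′ , rs″ ← Pointwise-↭ rs′ q = _ , ↭-trans p′ q′ , rs″

  Pointwise-∈ˡ : ∀ {x xs ys} → x ∈ xs → Pointwise R xs ys → ∃ λ y → y ∈ ys × R x y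
  Pointwise-∈ˡ (here refl) (r ∷ _) = _ , here refl , r
  Pointwise-∈ˡ (there x∈) (_ ∷ rs) with y , y∈ , r ← Pointwise-∈ˡ x∈ rs = y , there y∈ , r

  Pointwise-∈ʳ : ∀ {y xs ys} → y ∈ ys → Pointwise R xs ys → ∃ λ x → x ∈ xs × R x y
  Pointwise-∈ʳ (here refl) (r ∷ _) = _ , here refl , r
  Pointwise-∈ʳ (there y∈) (_ ∷ rs) with x , x∈ , r ← Pointwise-∈ʳ y∈ rs = x , there x∈ , r

  Pointwise-++⁻ʳ : ∀ {xs} ys₁ ys₂ → Pointwise R xs (ys₁ ++ ys₂) →
    ∃₂ λ xs₁ xs₂ → xs ≡ xs₁ ++ xs₂ × Pointwise R xs₁ ys₁ × Pointwise R xs₂ ys₂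
  Pointwise-++⁻ʳ [] ys₂ rs = [] , _ , refl , [] , rs
  Pointwise-++⁻ʳ (_ ∷ ys₁) ys₂ (r ∷ rs)
    with xs₁ , xs₂ , refl , rs₁ , rs₂ ← Pointwise-++⁻ʳ ys₁ ys₂ rs =
    _ ∷ xs₁ , xs₂ , refl , r ∷ rs₁ , rs₂

  Pointwise-≢[] : ∀ {xs ys} → Pointwise R xs ys → ys ≢ [] → xs ≢ []
  Pointwise-≢[] [] ys≢[] _ = ys≢[] refl

Dominates : {A : Set} → (A → A → Set) → List A → List A → Set
Dominates R S T = All (λ t → Any (λ s → R s t) S) T

-- The Dershowitz–Manna argument: one-step replacements are well-founded on
-- lists of accessible elements, and a multiset decrease is a chain of them.
module MultisetOrder {A : Set} (_>_ : A → A → Set) where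

  infix 4 _>₁_ _<₁_
  _>₁_ : List A → List A → Set
  M >₁ M′ = ∃₂ λ a X → ∃ λ K → M ↭ a ∷ X × M′ ↭ K ++ X × All (a >_) K

  _<₁_ : List A → List A → Set
  _<₁_ = flip _>₁_

  Acc₁ : List A → Set
  Acc₁ = Acc _<₁_

  Acc₁-resp-↭ : ∀ {M M′} → Acc₁ M → M ↭ M′ → Acc₁ M′
  Acc₁-resp-↭ (acc rs) M↭M′ =
    acc λ (a , X , K , p , q , a>K) → rs (a , X , K , ↭-trans M↭M′ p , q , a>K)

  module _ {a : A} (smaller-∷-Acc₁ : ∀ {b} → a > b → ∀ {M} → Acc₁ M → Acc₁ (b ∷ M)) where

    ++-Acc₁ : ∀ {K X} → All (a >_) K → Acc₁ X → Acc₁ (K ++ X)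
    ++-Acc₁ [] acc-X = acc-X
    ++-Acc₁ (a>b ∷ a>K) acc-X = smaller-∷-Acc₁ a>b (++-Acc₁ a>K acc-X)

    ∷-Acc₁′ : ∀ {M} → Acc₁ M → Acc₁ (a ∷ M)
    ∷-Acc₁′ {M} (acc rs) = acc λ (a₀ , X , K , p , q , a₀>K) →
      decrease p q a₀>K (∈-resp-↭ (↭-sym p) (here refl))
      where
      decrease : ∀ {N a₀ X K} → a ∷ M ↭ a₀ ∷ X → N ↭ K ++ X → All (a₀ >_) K → a₀ ∈ a ∷ M → Acc₁ N
      decrease p q a>K (here refl) =
        Acc₁-resp-↭ (++-Acc₁ a>K (Acc₁-resp-↭ (acc rs) (drop-∷ p))) (↭-sym q)
      decrease {a₀ = a₀} {X} {K} p q a₀>K (there a₀∈M) with M′ , M↭ ← ∈⇒↭∷ a₀∈M =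
        Acc₁-resp-↭ (∷-Acc₁′ (rs (a₀ , M′ , K , M↭ , ↭-refl , a₀>K)))
          (↭-sym (↭-trans q (↭-trans (++⁺ˡ K X↭) (shift a K M′))))
        where
        X↭ : X ↭ a ∷ M′
        X↭ = drop-∷ (↭-trans (↭-sym p) (↭-trans (prep a M↭) (swap a a₀ ↭-refl)))

  ∷-Acc₁ : ∀ {a} → Acc (flip _>_) a → ∀ {M} → Acc₁ M → Acc₁ (a ∷ M)
  ∷-Acc₁ (acc rs) = ∷-Acc₁′ (λ a>b → ∷-Acc₁ (rs a>b))

  All-Acc⇒Acc₁ : ∀ {M} → All (Acc (flip _>_)) M → Acc₁ M
  All-Acc⇒Acc₁ [] = acc λ (_ , _ , _ , p , _) → case ↭-empty-inv (↭-sym p) of λ ()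
  All-Acc⇒Acc₁ (acc-a ∷ acc-M) = ∷-Acc₁ acc-a (All-Acc⇒Acc₁ acc-M)

  <₁-pres-All-Acc : ∀ {M N} → All (Acc (flip _>_)) M → N <₁ M → All (Acc (flip _>_)) N
  <₁-pres-All-Acc acc-M (a , X , K , p , q , a>K) with acc-a ∷ acc-X ← All-resp-↭ p acc-M =
    All-resp-↭ (↭-sym q) (All.++⁺ (All.map (acc-inverse acc-a) a>K) acc-X)

  <₁⁺-pres-All-Acc : ∀ {M N} → All (Acc (flip _>_)) M → TransClosure _<₁_ N M →
    All (Acc (flip _>_)) N
  <₁⁺-pres-All-Acc acc-M Plus.[ N<M ] = <₁-pres-All-Acc acc-M N<M
  <₁⁺-pres-All-Acc acc-M (N<L Plus.∷ L<⁺M) = <₁-pres-All-Acc (<₁⁺-pres-All-Acc acc-M L<⁺M) N<L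

  Dominates-∷⁻ : ∀ {a S T} → Dominates _>_ (a ∷ S) T →
    ∃₂ λ K R → T ↭ K ++ R × All (a >_) K × Dominates _>_ S R
  Dominates-∷⁻ [] = [] , [] , ↭-refl , [] , []
  Dominates-∷⁻ (here a>t ∷ dom) with K , R , p , a>K , S≫R ← Dominates-∷⁻ dom =
    _ ∷ K , R , prep _ p , a>t ∷ a>K , S≫R
  Dominates-∷⁻ {T = t ∷ _} (there S>t ∷ dom) with K , R , p , a>K , S≫R ← Dominates-∷⁻ dom =
    K , t ∷ R , ↭-trans (prep t p) (↭-sym (shift t K R)) , a>K , S>t ∷ S≫R

  Dominates-[] : ∀ {R} → Dominates _>_ [] R → R ≡ []
  Dominates-[] [] = refl

  Dominates⇒<₁⁺ : ∀ S₂ X T₂ {M N} → S₂ ≢ [] → Dominates _>_ S₂ T₂ →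
    M ↭ X ++ S₂ → N ↭ X ++ T₂ → TransClosure _<₁_ N M
  Dominates⇒<₁⁺ [] X T₂ S₂≢[] _ _ _ = ⊥-elim (S₂≢[] refl)
  Dominates⇒<₁⁺ (a ∷ []) X T₂ _ dom M↭ N↭
    with K , R , T₂↭ , a>K , S₂≫R ← Dominates-∷⁻ dom
    with refl ← Dominates-[] S₂≫R =
    Plus.[ a , X ++ [] , K , ↭-trans M↭ (shift a X [])
         , ↭-trans N↭ (↭-trans (++⁺ˡ X T₂↭) (shifts X K)) , a>K ]
  Dominates⇒<₁⁺ (a ∷ b ∷ S₂) X T₂ _ dom M↭ N↭ =
    let K , R , T₂↭ , a>K , S₂≫R = Dominates-∷⁻ dom in
    Dominates⇒<₁⁺ (b ∷ S₂) (X ++ K) R (λ ()) S₂≫R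
      (↭-trans (shifts K X) (↭-reflexive (sym (List.++-assoc X K (b ∷ S₂)))))
      (↭-trans N↭ (↭-trans (++⁺ˡ X T₂↭) (↭-reflexive (sym (List.++-assoc X K R)))))
    ∷ʳ (a , X ++ b ∷ S₂ , K , ↭-trans M↭ (shift a X (b ∷ S₂)) , ↭-refl , a>K)

module Multisets {A : Set} {_≈_ : A → A → Set} (≈-isEquivalence : IsEquivalence _≈_) where

  open IsEquivalence ≈-isEquivalence
    using () renaming (refl to ≈-refl; sym to ≈-sym; trans to ≈-trans)

  infix 4 _≋_
  _≋_ : List A → List A → Set
  xs ≋ ys = ∃ λ zs → xs ↭ zs × Pointwise _≈_ zs ys

  ≋-refl : ∀ {xs} → xs ≋ xs
  ≋-refl = _ , ↭-refl , Pointwise.refl ≈-refl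

  ↭⇒≋ : ∀ {xs ys} → xs ↭ ys → xs ≋ ys
  ↭⇒≋ p = _ , p , Pointwise.refl ≈-refl

  ≋-sym : ∀ {xs ys} → xs ≋ ys → ys ≋ xs
  ≋-sym (_ , p , rs) = Pointwise-↭ (Pointwise.symmetric ≈-sym rs) (↭-sym p)

  ≋-trans : ∀ {xs ys zs} → xs ≋ ys → ys ≋ zs → xs ≋ zs
  ≋-trans (_ , p , rs) (_ , q , rs′) with _ , q′ , rs″ ← Pointwise-↭ rs q =
    _ , ↭-trans p q′ , Pointwise.transitive ≈-trans rs″ rs′

  ≋-++ : ∀ {xs ys us vs} → xs ≋ ys → us ≋ vs → xs ++ us ≋ ys ++ vs
  ≋-++ (_ , p , rs) (_ , q , rs′) = _ , ++⁺ p q , Pointwise.++⁺ rs rs′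

  ∈-resp-≋ : ∀ {x xs ys} → x ∈ xs → xs ≋ ys → ∃ λ y → y ∈ ys × x ≈ y
  ∈-resp-≋ x∈ (_ , p , rs) = Pointwise-∈ˡ (∈-resp-↭ p x∈) rs

  ∈-resp-≋⁻ : ∀ {y xs ys} → y ∈ ys → xs ≋ ys → ∃ λ x → x ∈ xs × x ≈ y
  ∈-resp-≋⁻ y∈ xs≋ys with x , x∈ , y≈x ← ∈-resp-≋ y∈ (≋-sym xs≋ys) = x , x∈ , ≈-sym y≈x

  All-resp-≋ : ∀ {P Q : A → Set} → (∀ {x y} → P x → x ≈ y → Q y) →
    ∀ {xs ys} → All P xs → xs ≋ ys → All Q ys
  All-resp-≋ P≈⇒Q all-P xs≋ys = All.tabulate λ y∈ →
    let x , x∈ , x≈y = ∈-resp-≋⁻ y∈ xs≋ys in P≈⇒Q (All.lookup all-P x∈) x≈y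

  ≋-++⁻ʳ : ∀ {xs} ys₁ ys₂ → xs ≋ ys₁ ++ ys₂ →
    ∃₂ λ xs₁ xs₂ → xs ↭ xs₁ ++ xs₂ × Pointwise _≈_ xs₁ ys₁ × Pointwise _≈_ xs₂ ys₂
  ≋-++⁻ʳ ys₁ ys₂ (_ , p , rs) with xs₁ , xs₂ , refl , rs₁ , rs₂ ← Pointwise-++⁻ʳ ys₁ ys₂ rs =
    xs₁ , xs₂ , p , rs₁ , rs₂

  concatMap-≋ : ∀ (F : A → List A) → (∀ {x y} → x ≈ y → F x ≋ F y) →
    ∀ {xs ys} → Pointwise _≈_ xs ys → concatMap F xs ≋ concatMap F ys
  concatMap-≋ F F-resp [] = ≋-refl
  concatMap-≋ F F-resp (r ∷ rs) = ≋-++ (F-resp r) (concatMap-≋ F F-resp rs)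

  -- The multiset extension of R modulo ≈, in the form of the third AC-MPO clause.
  record MulExt (R : A → A → Set) (S T : List A) : Set where
    constructor mulExt
    field
      S₁ S₂ T₁ T₂ : List A
      S↭ : S ↭ S₁ ++ S₂
      T↭ : T ↭ T₁ ++ T₂
      S₁≈T₁ : Pointwise _≈_ S₁ T₁
      S₂≢[] : S₂ ≢ []
      S₂≫T₂ : Dominates R S₂ T₂

  module _ {R : A → A → Set} where

    Dominates⇒MulExt : ∀ {S T} → S ≢ [] → Dominates R S T → MulExt R S T
    Dominates⇒MulExt S≢[] S≫T = mulExt [] _ [] _ ↭-refl ↭-refl [] S≢[] S≫T

    MulExt-resp-↭ : ∀ {S S′ T T′} → S ↭ S′ → T ↭ T′ → MulExt R S T → MulExt R S′ T′
    MulExt-resp-↭ S↭S′ T↭T′ (mulExt S₁ S₂ T₁ T₂ p q rs ne dom) =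
      mulExt S₁ S₂ T₁ T₂ (↭-trans (↭-sym S↭S′) p) (↭-trans (↭-sym T↭T′) q) rs ne dom

    MulExt-++ˡ : ∀ U {S T} → MulExt R S T → MulExt R (U ++ S) (U ++ T)
    MulExt-++ˡ U (mulExt S₁ S₂ T₁ T₂ p q rs ne dom) =
      mulExt (U ++ S₁) S₂ (U ++ T₁) T₂ (split p) (split q)
        (Pointwise.++⁺ (Pointwise.refl ≈-refl) rs) ne dom
      where
      split : ∀ {X X₁ X₂} → X ↭ X₁ ++ X₂ → U ++ X ↭ (U ++ X₁) ++ X₂
      split {X₁ = X₁} p = ↭-trans (++⁺ˡ U p) (↭-reflexive (sym (List.++-assoc U X₁ _)))

    MulExt-cover : ∀ {S T t} → MulExt R S T → t ∈ T → ∃ λ s → s ∈ S × (R s t ⊎ s ≈ t)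
    MulExt-cover (mulExt S₁ S₂ T₁ T₂ p q rs _ dom) t∈ with ∈-++⁻ T₁ (∈-resp-↭ q t∈)
    ... | inj₁ t∈T₁ with s , s∈ , s≈t ← Pointwise-∈ʳ t∈T₁ rs =
      s , ∈-resp-↭ (↭-sym p) (∈-++⁺ˡ s∈) , inj₂ s≈t
    ... | inj₂ t∈T₂ with s , s∈ , Rst ← find (All.lookup dom t∈T₂) =
      s , ∈-resp-↭ (↭-sym p) (∈-++⁺ʳ S₁ s∈) , inj₁ Rst

    MulExt-respˡ-≋ : ∀ {Q : A → A → Set} → (∀ {s′ s t} → s′ ≈ s → R s t → Q s′ t) →
      ∀ {S′ S T} → S′ ≋ S → MulExt R S T → MulExt Q S′ T
    MulExt-respˡ-≋ {Q} ≈R⇒Q S′≋S (mulExt S₁ S₂ T₁ T₂ p q rs ne dom)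
      with A₁ , A₂ , p′ , A₁≈ , A₂≈ ← ≋-++⁻ʳ S₁ S₂ (≋-trans S′≋S (↭⇒≋ p)) =
      mulExt A₁ A₂ T₁ T₂ p′ q (Pointwise.transitive ≈-trans A₁≈ rs) (Pointwise-≢[] A₂≈ ne)
        (All.map transport dom)
      where
      transport : ∀ {t} → Any (λ s → R s t) S₂ → Any (λ a → Q a t) A₂
      transport S₂>t with s , s∈ , Rst ← find S₂>t
                     with a , a∈ , a≈s ← Pointwise-∈ʳ s∈ A₂≈ =
        lose a∈ (≈R⇒Q a≈s Rst)

    MulExt-respʳ-≋ : ∀ {Q : A → A → Set} → (∀ {s t u} → R s t → t ≈ u → Q s u) →
      ∀ {S T U} → MulExt R S T → T ≋ U → MulExt Q S U
    MulExt-respʳ-≋ {Q} R≈⇒Q (mulExt S₁ S₂ T₁ T₂ p q rs ne dom) T≋U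
      with B₁ , B₂ , q′ , B₁≈ , B₂≈ ← ≋-++⁻ʳ T₁ T₂ (≋-trans (≋-sym T≋U) (↭⇒≋ q)) =
      mulExt S₁ S₂ B₁ B₂ p q′ (Pointwise.transitive ≈-trans rs (Pointwise.symmetric ≈-sym B₁≈)) ne
        (All.tabulate transport)
      where
      transport : ∀ {u} → u ∈ B₂ → Any (λ s → Q s u) S₂
      transport u∈ with x , x∈ , u≈x ← Pointwise-∈ˡ u∈ B₂≈
                   with s , s∈ , Rsx ← find (All.lookup dom x∈) =
        lose s∈ (R≈⇒Q Rsx (≈-sym u≈x))

    MulExt⇒<₁⁺ : ∀ {M T} → MulExt R M T → ∃ λ N → TransClosure (MultisetOrder._<₁_ R) N M × T ≋ N
    MulExt⇒<₁⁺ (mulExt M₁ M₂ T₁ T₂ p q rs ne dom) =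
      M₁ ++ T₂ , MultisetOrder.Dominates⇒<₁⁺ R M₂ M₁ T₂ ne dom p ↭-refl
      , T₁ ++ T₂ , q , Pointwise.++⁺ (Pointwise.symmetric ≈-sym rs) (Pointwise.refl ≈-refl)

  MulExt-All : ∀ {R : A → A → Set} {P Q : A → Set} →
    (∀ {x y} → P x → x ≈ y → Q y) → (∀ {x y} → P x → R x y → Q y) →
    ∀ {T U} → All P T → MulExt R T U → All Q U
  MulExt-All {R} {P} {Q} P≈⇒Q PR⇒Q {T} all-P T>U = All.tabulate λ u∈ → below (MulExt-cover T>U u∈)
    where
    below : ∀ {u} → (∃ λ t → t ∈ T × (R t u ⊎ t ≈ u)) → Q u
    below (t , t∈ , inj₁ Rtu) = PR⇒Q (All.lookup all-P t∈) Rtu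
    below (t , t∈ , inj₂ t≈u) = P≈⇒Q (All.lookup all-P t∈) t≈u

  MulExt-trans : ∀ {R Q : A → A → Set} →
    (∀ {s t u} → R s t → t ≈ u → Q s u) →
    (∀ {s t u} → s ≈ t → Q t u → Q s u) →
    (∀ {s t u} → R s t → Q t u → Q s u) →
    ∀ {S T U} → MulExt R S T → MulExt Q T U → MulExt Q S U
  MulExt-trans {R} {Q} R≈⇒Q ≈Q⇒Q RQ⇒Q
    (mulExt S₁ S₂ T₁ T₂ S↭ T↭ S₁≈T₁ S₂≢[] S₂≫T₂)
    (mulExt T₁′ T₂′ U₁ U₂ T↭′ U↭ T₁′≈U₁ _ T₂′≫U₂)
    with a , b , c , d , T₁↭ , T₂↭ , T₁′↭ , T₂′↭
           ← ++↭++-refine T₁ T₂ T₁′ T₂′ (↭-trans (↭-sym T↭) T↭′)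
    with S₁′ , S₁↭ , S₁′≈ ← Pointwise-↭ S₁≈T₁ T₁↭
    with U₁′ , U₁↭ , U₁′≈ ← Pointwise-↭ (Pointwise.symmetric ≈-sym T₁′≈U₁) T₁′↭
    with Sa , Sb , refl , Sa≈a , Sb≈b ← Pointwise-++⁻ʳ a b S₁′≈
    with Ua , Uc , refl , Ua≈a , Uc≈c ← Pointwise-++⁻ʳ a c U₁′≈
    = mulExt Sa (Sb ++ S₂) Ua (Uc ++ U₂)
        (↭-trans S↭ (↭-trans (++⁺ʳ S₂ S₁↭) (↭-reflexive (List.++-assoc Sa Sb S₂))))
        (↭-trans U↭ (↭-trans (++⁺ʳ U₂ U₁↭) (↭-reflexive (List.++-assoc Ua Uc U₂))))
        (Pointwise.transitive ≈-trans Sa≈a (Pointwise.symmetric ≈-sym Ua≈a))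
        (++-≢[]ʳ Sb S₂≢[])
        (All.++⁺ (All.tabulate below-Uc) (All.tabulate below-U₂))
    where
    below-T₂ : ∀ {x y} → x ∈ T₂ → (∀ {s} → R s x → Q s y) → Any (λ s → Q s y) (Sb ++ S₂)
    below-T₂ x∈ R⇒Q with s , s∈ , Rsx ← find (All.lookup S₂≫T₂ x∈) = lose (∈-++⁺ʳ Sb s∈) (R⇒Q Rsx)

    below-Uc : ∀ {y} → y ∈ Uc → Any (λ s → Q s y) (Sb ++ S₂)
    below-Uc y∈ with x , x∈ , y≈x ← Pointwise-∈ˡ y∈ Uc≈c =
      below-T₂ (∈-resp-↭ (↭-sym T₂↭) (∈-++⁺ˡ x∈)) (λ Rsx → R≈⇒Q Rsx (≈-sym y≈x))

    below-U₂ : ∀ {y} → y ∈ U₂ → Any (λ s → Q s y) (Sb ++ S₂)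
    below-U₂ y∈ with x , x∈ , Qxy ← find (All.lookup T₂′≫U₂ y∈)
                  with ∈-++⁻ b (∈-resp-↭ T₂′↭ x∈)
    ... | inj₁ x∈b with s , s∈ , s≈x ← Pointwise-∈ʳ x∈b Sb≈b = lose (∈-++⁺ˡ s∈) (≈Q⇒Q s≈x Qxy)
    ... | inj₂ x∈d = below-T₂ (∈-resp-↭ (↭-sym T₂↭) (∈-++⁺ʳ c x∈d)) (λ Rsx → RQ⇒Q Rsx Qxy)

module ACMPO (N : Set) (arity : N → ℕ) (k : ℕ) where

  Tm : Set
  Tm = Term N arity k

  Symbol : Set
  Symbol = Sym N arity k

  infix 4 _≈_
  _≈_ : Tm → Tm → Set
  _≈_ = _=AC_ N arity k

  ≈-isEquivalence : IsEquivalence _≈_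
  ≈-isEquivalence = record { refl = ac-refl ; sym = ac-sym ; trans = ac-trans }

  open Multisets ≈-isEquivalence public

  root′ : Tm → ℕ ⊎ Symbol
  root′ = root N arity k

  NonVar′ : Tm → Set
  NonVar′ = NonVar N arity k

  TF′ : Tm → List Tm
  TF′ = TF N arity k

  TFf′ : Fin k → Tm → List Tm
  TFf′ = TFf N arity k

  RootedAt : Fin k → Tm → Set
  RootedAt f t = root′ t ≡ inj₂ (inj₂ f)

  root⇒NonVar : ∀ {t g} → root′ t ≡ inj₂ g → NonVar′ t
  root⇒NonVar {fun _ _} _ = tt
  root⇒NonVar {ac _ _ _} _ = tt

  NonVar-resp-root : ∀ {s t} → root′ s ≡ root′ t → NonVar′ s → NonVar′ t
  NonVar-resp-root {fun _ _} r _ = root⇒NonVar (sym r)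
  NonVar-resp-root {ac _ _ _} r _ = root⇒NonVar (sym r)

  TFf-rooted : ∀ f u v → TFf′ f (ac f u v) ≡ TFf′ f u ++ TFf′ f v
  TFf-rooted f u v with f ≟ f
  ... | yes _ = refl
  ... | no f≢f = ⊥-elim (f≢f refl)

  TFf-other : ∀ {f g} u v → f ≢ g → TFf′ f (ac g u v) ≡ [ ac g u v ]
  TFf-other {f} {g} u v f≢g with f ≟ g
  ... | yes f≡g = ⊥-elim (f≢g f≡g)
  ... | no _ = refl

  TFf-of-rooted : ∀ f u → RootedAt f u → TFf′ f u ≡ TF′ u
  TFf-of-rooted f (ac .f u v) refl = TFf-rooted f u v

  TFf-unrooted : ∀ f u → ¬ RootedAt f u → TFf′ f u ≡ [ u ]
  TFf-unrooted f (var _) _ = refl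
  TFf-unrooted f (fun _ _) _ = refl
  TFf-unrooted f (ac g u v) ¬f-root with f ≟ g
  ... | yes refl = ⊥-elim (¬f-root refl)
  ... | no _ = refl

  TFf-cases : ∀ f u → TFf′ f u ≡ [ u ] ⊎ (RootedAt f u × TFf′ f u ≡ TF′ u)
  TFf-cases f (var _) = inj₁ refl
  TFf-cases f (fun _ _) = inj₁ refl
  TFf-cases f (ac g u v) with f ≟ g
  ... | yes refl = inj₂ (refl , refl)
  ... | no _ = inj₁ refl

  ∈-TFf⇒unrooted : ∀ f u {t} → t ∈ TFf′ f u → ¬ RootedAt f t
  ∈-TFf⇒unrooted f (ac g u v) t∈ with f ≟ g
  ∈-TFf⇒unrooted f (ac g u v) (here refl) | no f≢g = f≢g ∘ sym ∘ inj₂-injective ∘ inj₂-injective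
  ∈-TFf⇒unrooted f (ac g u v) t∈ | yes refl with ∈-++⁻ (TFf′ f u) t∈
  ... | inj₁ t∈u = ∈-TFf⇒unrooted f u t∈u
  ... | inj₂ t∈v = ∈-TFf⇒unrooted f v t∈v
  ∈-TFf⇒unrooted f (var _) (here refl) ()
  ∈-TFf⇒unrooted f (fun _ _) (here refl) ()

  ∈-TF⇒unrooted : ∀ {f u v t} → t ∈ TF′ (ac f u v) → ¬ RootedAt f t
  ∈-TF⇒unrooted {f} {u} {v} t∈ with ∈-++⁻ (TFf′ f u) t∈
  ... | inj₁ t∈u = ∈-TFf⇒unrooted f u t∈u
  ... | inj₂ t∈v = ∈-TFf⇒unrooted f v t∈v

  TFf-≢[] : ∀ f u → TFf′ f u ≢ []
  TFf-≢[] f u with TFf-cases f u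
  ... | inj₁ eq = λ eq′ → case ≡-trans (sym eq) eq′ of λ ()
  TFf-≢[] f (ac .f u v) | inj₂ (refl , eq) =
    TFf-≢[] f u ∘ List.++-conicalˡ (TFf′ f u) _ ∘ ≡-trans (sym eq)

  TF-ac-↭∷⇒≢[] : ∀ {f u v x rest} → TF′ (ac f u v) ↭ x ∷ rest → rest ≢ []
  TF-ac-↭∷⇒≢[] {f} {u} {v} p refl with TFf′ f u | TFf-≢[] f u | ↭-singleton-inv p
  ... | [] | u≢[] | _ = u≢[] refl
  ... | _ ∷ ys | _ | eq = ++-≢[]ʳ ys (TFf-≢[] f v) (proj₂ (List.∷-injective eq))

  root-resp-≈ : ∀ {s t} → s ≈ t → root′ s ≡ root′ t
  root-resp-≈ ac-refl = refl
  root-resp-≈ (ac-sym p) = sym (root-resp-≈ p)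
  root-resp-≈ (ac-trans p q) = ≡-trans (root-resp-≈ p) (root-resp-≈ q)
  root-resp-≈ (ac-cong-fun _ _) = refl
  root-resp-≈ (ac-cong-ac _ _ _) = refl
  root-resp-≈ (ac-assoc _ _ _ _) = refl
  root-resp-≈ (ac-comm _ _ _) = refl

  NonVar-resp-≈ : ∀ {s t} → s ≈ t → NonVar′ s → NonVar′ t
  NonVar-resp-≈ s≈t = NonVar-resp-root (root-resp-≈ s≈t)

  Pointwise-toList : ∀ {n} {ts us : Vec Tm n} →
    VecPointwise.Pointwise _≈_ ts us → Pointwise _≈_ (toList ts) (toList us)
  Pointwise-toList VecPointwise.[] = []
  Pointwise-toList (r VecPointwise.∷ rs) = r ∷ Pointwise-toList rs

  TFf-resp-≈ : ∀ f {s t} → s ≈ t → TFf′ f s ≋ TFf′ f t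
  TFf-resp-≈ f ac-refl = ≋-refl
  TFf-resp-≈ f (ac-sym p) = ≋-sym (TFf-resp-≈ f p)
  TFf-resp-≈ f (ac-trans p q) = ≋-trans (TFf-resp-≈ f p) (TFf-resp-≈ f q)
  TFf-resp-≈ f p@(ac-cong-fun _ _) = _ , ↭-refl , p ∷ []
  TFf-resp-≈ f p@(ac-cong-ac g q r) with f ≟ g
  ... | yes refl = ≋-++ (TFf-resp-≈ f q) (TFf-resp-≈ f r)
  ... | no _ = _ , ↭-refl , p ∷ []
  TFf-resp-≈ f p@(ac-assoc g x y z) with f ≟ g
  ... | yes refl rewrite TFf-rooted f x y | TFf-rooted f y z =
    ↭⇒≋ (++-assoc (TFf′ f x) (TFf′ f y) (TFf′ f z))
  ... | no _ = _ , ↭-refl , p ∷ []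
  TFf-resp-≈ f p@(ac-comm g x y) with f ≟ g
  ... | yes refl = ↭⇒≋ (++-comm (TFf′ f x) (TFf′ f y))
  ... | no _ = _ , ↭-refl , p ∷ []

  TF-resp-≈ : ∀ {s t} → s ≈ t → TF′ s ≋ TF′ t
  TF-resp-≈ ac-refl = ≋-refl
  TF-resp-≈ (ac-sym p) = ≋-sym (TF-resp-≈ p)
  TF-resp-≈ (ac-trans p q) = ≋-trans (TF-resp-≈ p) (TF-resp-≈ q)
  TF-resp-≈ (ac-cong-fun _ ps) = _ , ↭-refl , Pointwise-toList ps
  TF-resp-≈ (ac-cong-ac f p q) = ≋-++ (TFf-resp-≈ f p) (TFf-resp-≈ f q)
  TF-resp-≈ (ac-assoc f x y z) rewrite TFf-rooted f x y | TFf-rooted f y z =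
    ↭⇒≋ (++-assoc (TFf′ f x) (TFf′ f y) (TFf′ f z))
  TF-resp-≈ (ac-comm f x y) = ↭⇒≋ (++-comm (TFf′ f x) (TFf′ f y))

  module Order (_≻_ : Symbol → Symbol → Set) where

    infix 4 _>_
    _>_ : Tm → Tm → Set
    _>_ = _>acmpo_ N arity k _≻_

    >⇒NonVar : ∀ {s t} → s > t → NonVar′ s
    >⇒NonVar (acmpo1 nv _ _) = nv
    >⇒NonVar (acmpo2 rs _ _ _) = root⇒NonVar rs
    >⇒NonVar (acmpo3 _ _ _ _ nv _ _ _ _ _ _) = nv

    var-minimal : ∀ {x t} → ¬ var x > t
    var-minimal = >⇒NonVar

    >-TF : ∀ {s t} → NonVar′ s → t ∈ TF′ s → s > t
    >-TF nv t∈ = acmpo1 nv t∈ (inj₂ ac-refl)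

    MulExt⇒> : ∀ {s t} → NonVar′ s → root′ s ≡ root′ t → MulExt _>_ (TF′ s) (TF′ t) → s > t
    MulExt⇒> nv r (mulExt S₁ S₂ T₁ T₂ p q rs ne dom) = acmpo3 S₁ S₂ T₁ T₂ nv r p q rs ne dom

    >-⊂ : ∀ {s t R} → NonVar′ s → root′ s ≡ root′ t → TF′ s ↭ TF′ t ++ R → R ≢ [] → s > t
    >-⊂ nv r p R≢[] = MulExt⇒> nv r
      (mulExt _ _ _ [] p (↭-sym (++-identityʳ _)) (Pointwise.refl ac-refl) R≢[] [])

    _≈>_ : Tm → Tm → Set
    s ≈> t = ∀ {s′} → s′ ≈ s → s′ > t

    _>≈_ : Tm → Tm → Set
    s >≈ t = ∀ {u} → t ≈ u → s > u

    mutual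
      >-respˡ-≈ : ∀ {s s′ t} → s ≈ s′ → s′ > t → s > t
      >-respˡ-≈ e (acmpo1 nv m (inj₁ d)) with x , x∈ , x≈ ← ∈-resp-≋⁻ m (TF-resp-≈ e) =
        acmpo1 (NonVar-resp-≈ (ac-sym e) nv) x∈ (inj₁ (>-respˡ-≈ x≈ d))
      >-respˡ-≈ e (acmpo1 nv m (inj₂ d)) with x , x∈ , x≈ ← ∈-resp-≋⁻ m (TF-resp-≈ e) =
        acmpo1 (NonVar-resp-≈ (ac-sym e) nv) x∈ (inj₂ (ac-trans x≈ d))
      >-respˡ-≈ e (acmpo2 rs rt f≻g s>TFt) =
        acmpo2 (≡-trans (root-resp-≈ e) rs) rt f≻g (All->-respˡ-≈ e s>TFt)
      >-respˡ-≈ e (acmpo3 S₁ S₂ T₁ T₂ nv r p q rs ne dom) =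
        MulExt⇒> (NonVar-resp-≈ (ac-sym e) nv) (≡-trans (root-resp-≈ e) r)
          (MulExt-respˡ-≋ (λ s′≈s s≈>t → s≈>t s′≈s) (TF-resp-≈ e)
            (mulExt S₁ S₂ T₁ T₂ p q rs ne (Dominates-≈> dom)))

      All->-respˡ-≈ : ∀ {s s′ xs} → s ≈ s′ → All (s′ >_) xs → All (s >_) xs
      All->-respˡ-≈ e [] = []
      All->-respˡ-≈ e (d ∷ ds) = >-respˡ-≈ e d ∷ All->-respˡ-≈ e ds

      Dominates-≈> : ∀ {S T} → Dominates _>_ S T → Dominates _≈>_ S T
      Dominates-≈> [] = []
      Dominates-≈> (S>t ∷ dom) = Any-≈> S>t ∷ Dominates-≈> dom

      Any-≈> : ∀ {S t} → Any (_> t) S → Any (_≈> t) S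
      Any-≈> (here d) = here (λ e → >-respˡ-≈ e d)
      Any-≈> (there S>t) = there (Any-≈> S>t)

    mutual
      >-respʳ-≈ : ∀ {s t u} → s > t → t ≈ u → s > u
      >-respʳ-≈ (acmpo1 nv m (inj₁ d)) e = acmpo1 nv m (inj₁ (>-respʳ-≈ d e))
      >-respʳ-≈ (acmpo1 nv m (inj₂ d)) e = acmpo1 nv m (inj₂ (ac-trans d e))
      >-respʳ-≈ (acmpo2 rs rt f≻g s>TFt) e =
        acmpo2 rs (≡-trans (sym (root-resp-≈ e)) rt) f≻g
          (All-resp-≋ (λ s>≈x x≈u → s>≈x x≈u) (All->≈ s>TFt) (TF-resp-≈ e))
      >-respʳ-≈ (acmpo3 S₁ S₂ T₁ T₂ nv r p q rs ne dom) e =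
        MulExt⇒> nv (≡-trans r (root-resp-≈ e))
          (MulExt-respʳ-≋ (λ s>≈t t≈u → s>≈t t≈u)
            (mulExt S₁ S₂ T₁ T₂ p q rs ne (Dominates->≈ dom)) (TF-resp-≈ e))

      All->≈ : ∀ {s xs} → All (s >_) xs → All (s >≈_) xs
      All->≈ [] = []
      All->≈ (d ∷ ds) = (λ e → >-respʳ-≈ d e) ∷ All->≈ ds

      Dominates->≈ : ∀ {S T} → Dominates _>_ S T → Dominates _>≈_ S T
      Dominates->≈ [] = []
      Dominates->≈ (S>t ∷ dom) = Any->≈ S>t ∷ Dominates->≈ dom

      Any->≈ : ∀ {S t} → Any (_> t) S → Any (_>≈ t) S
      Any->≈ (here d) = here (λ e → >-respʳ-≈ d e)
      Any->≈ (there S>t) = there (Any->≈ S>t)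

    >-AC-compatible : ∀ {s s′ t′ t} → s ≈ s′ → s′ > t′ → t′ ≈ t → s > t
    >-AC-compatible e d e′ = >-respˡ-≈ e (>-respʳ-≈ d e′)

    module Transitivity (≻-trans : ∀ {f g h} → f ≻ g → g ≻ h → f ≻ h) where

      -- Producing these pairs by structural recursion is what lets the
      -- termination checker accept >-trans.
      _>ᵗ_ : Tm → Tm → Set
      s >ᵗ t = s > t × (∀ {u} → t > u → s > u)

      ≥-trans : ∀ {s t u} → s >ᵗ t ⊎ s ≈ t → t > u ⊎ t ≈ u → s > u ⊎ s ≈ u
      ≥-trans (inj₁ (_ , s>t>)) (inj₁ t>u) = inj₁ (s>t> t>u)
      ≥-trans (inj₁ (s>t , _)) (inj₂ t≈u) = inj₁ (>-respʳ-≈ s>t t≈u)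
      ≥-trans (inj₂ s≈t) (inj₁ t>u) = inj₁ (>-respˡ-≈ s≈t t>u)
      ≥-trans (inj₂ s≈t) (inj₂ t≈u) = inj₂ (ac-trans s≈t t≈u)

      >ᵗ-respʳ-≈ : ∀ {s t u} → s >ᵗ t → t ≈ u → s > u
      >ᵗ-respʳ-≈ (s>t , _) = >-respʳ-≈ s>t

      >ᵗ-trans : ∀ {s t u} → s >ᵗ t → t > u → s > u
      >ᵗ-trans (_ , s>t>) = s>t>

      mutual
        >-trans : ∀ {s t u} → s > t → t > u → s > u
        >-trans (acmpo1 nv m (inj₁ d)) t>u = acmpo1 nv m (inj₁ (>-trans d t>u))
        >-trans (acmpo1 nv m (inj₂ e)) t>u = acmpo1 nv m (inj₁ (>-respˡ-≈ e t>u))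
        >-trans (acmpo2 _ _ _ s>TFt) (acmpo1 _ m (inj₁ d)) =
          >ᵗ-trans (All.lookup (All->ᵗ s>TFt) m) d
        >-trans (acmpo2 _ _ _ s>TFt) (acmpo1 _ m (inj₂ e)) = >-respʳ-≈ (All.lookup s>TFt m) e
        >-trans s>t@(acmpo2 rs rt f≻g _) (acmpo2 rt′ ru g≻h t>TFu) =
          acmpo2 rs ru (≻-trans f≻g (subst (_≻ _) (inj₂-injective (≡-trans (sym rt′) rt)) g≻h))
            (All->-trans s>t t>TFu)
        >-trans (acmpo2 rs rt f≻g s>TFt) (acmpo3 T₁ T₂ U₁ U₂ _ r p q rs′ ne dom) =
          acmpo2 rs (≡-trans (sym r) rt) f≻g
            (MulExt-All >ᵗ-respʳ-≈ >ᵗ-trans (All->ᵗ s>TFt) (mulExt T₁ T₂ U₁ U₂ p q rs′ ne dom))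
        >-trans (acmpo3 S₁ S₂ T₁ T₂ nv _ p q rs ne dom) (acmpo1 _ m t′≥u)
          with s′ , s′∈ , s′≥t′ ← MulExt-cover (mulExt S₁ S₂ T₁ T₂ p q rs ne (Dominates->ᵗ dom)) m =
          acmpo1 nv s′∈ (≥-trans s′≥t′ t′≥u)
        >-trans s>t@(acmpo3 _ _ _ _ _ r _ _ _ _ _) (acmpo2 rt ru g≻h t>TFu) =
          acmpo2 (≡-trans r rt) ru g≻h (All->-trans s>t t>TFu)
        >-trans (acmpo3 S₁ S₂ T₁ T₂ nv r p q rs ne dom)
                (acmpo3 T₁′ T₂′ U₁ U₂ _ r′ p′ q′ rs′ ne′ dom′) =
          MulExt⇒> nv (≡-trans r r′)
            (MulExt-trans >ᵗ-respʳ-≈ >-respˡ-≈ >ᵗ-trans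
              (mulExt S₁ S₂ T₁ T₂ p q rs ne (Dominates->ᵗ dom))
              (mulExt T₁′ T₂′ U₁ U₂ p′ q′ rs′ ne′ dom′))

        All->ᵗ : ∀ {s xs} → All (s >_) xs → All (s >ᵗ_) xs
        All->ᵗ [] = []
        All->ᵗ (d ∷ ds) = (d , λ d′ → >-trans d d′) ∷ All->ᵗ ds

        Dominates->ᵗ : ∀ {S T} → Dominates _>_ S T → Dominates _>ᵗ_ S T
        Dominates->ᵗ [] = []
        Dominates->ᵗ (S>t ∷ dom) = Any->ᵗ S>t ∷ Dominates->ᵗ dom

        Any->ᵗ : ∀ {S t} → Any (_> t) S → Any (_>ᵗ t) S
        Any->ᵗ (here d) = here (d , λ d′ → >-trans d d′)
        Any->ᵗ (there S>t) = there (Any->ᵗ S>t)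

        All->-trans : ∀ {s t xs} → s > t → All (t >_) xs → All (s >_) xs
        All->-trans s>t [] = []
        All->-trans s>t (d ∷ ds) = >-trans s>t d ∷ All->-trans s>t ds

      >-TFf : ∀ f {s t} → s > t → All (s >_) (TFf′ f t)
      >-TFf f {t = t} s>t with TFf-cases f t
      ... | inj₁ eq rewrite eq = s>t ∷ []
      ... | inj₂ (t-root , eq) rewrite eq =
        All.tabulate λ x∈ → >-trans s>t (>-TF (root⇒NonVar t-root) x∈)

      module WellFoundedness (≻-wf : WellFounded (flip _≻_)) where

        open MultisetOrder _>_

        Acc> : Tm → Set
        Acc> = Acc (flip _>_)

        Acc>-resp-≈ : ∀ {s s′} → Acc> s → s ≈ s′ → Acc> s′
        Acc>-resp-≈ (acc rs) e = acc λ d → rs (>-respˡ-≈ e d)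

        AccIfArgsAcc : Symbol → Set
        AccIfArgsAcc g = ∀ t → root′ t ≡ inj₂ g → All Acc> (TF′ t) → Acc> t

        -- Inner induction, on the flattened arguments in the multiset order; the
        -- outer one, on the root symbol, supplies acc-smaller-root.
        Acc-by-TF : ∀ g → (∀ {h} → g ≻ h → AccIfArgsAcc h) →
          ∀ M → Acc (TransClosure _<₁_) M → All Acc> M →
          ∀ t → root′ t ≡ inj₂ g → TF′ t ≋ M → Acc> t
        Acc-by-TF g acc-smaller-root M (acc rs) acc-M t rt TFt≋M = acc below-t
          where
          mutual
            below-t : ∀ {u} → t > u → Acc> u
            below-t (acmpo1 _ m (inj₁ d)) with x , x∈ , e ← ∈-resp-≋ m TFt≋M =
              acc-inverse (Acc>-resp-≈ (All.lookup acc-M x∈) (ac-sym e)) d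
            below-t (acmpo1 _ m (inj₂ e′)) with x , x∈ , e ← ∈-resp-≋ m TFt≋M =
              Acc>-resp-≈ (All.lookup acc-M x∈) (ac-trans (ac-sym e) e′)
            below-t (acmpo2 rt′ ru g≻h t>TFu) =
              acc-smaller-root (subst (_≻ _) (inj₂-injective (≡-trans (sym rt′) rt)) g≻h) _ ru
                (All-below-t t>TFu)
            below-t (acmpo3 S₁ S₂ T₁ T₂ _ r p q rs′ ne dom)
              with N , N<⁺M , TFu≋N ← MulExt⇒<₁⁺ (MulExt-respˡ-≋ >-respˡ-≈ (≋-sym TFt≋M)
                                         (mulExt S₁ S₂ T₁ T₂ p q rs′ ne dom)) =
              Acc-by-TF g acc-smaller-root N (rs N<⁺M) (<₁⁺-pres-All-Acc acc-M N<⁺M)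
                _ (≡-trans (sym r) rt) TFu≋N

            All-below-t : ∀ {xs} → All (t >_) xs → All Acc> xs
            All-below-t [] = []
            All-below-t (d ∷ ds) = below-t d ∷ All-below-t ds

        Acc-by-root : ∀ g → Acc (flip _≻_) g → AccIfArgsAcc g
        Acc-by-root g (acc rs) t rt acc-TFt =
          Acc-by-TF g (λ g≻h → Acc-by-root _ (rs g≻h)) (TF′ t)
            (Plus.accessible _<₁_ (All-Acc⇒Acc₁ acc-TFt)) acc-TFt t rt ≋-refl

        Acc-TFf : ∀ f {u} → Acc> u → All Acc> (TFf′ f u)
        Acc-TFf f {u} acc-u with TFf-cases f u
        ... | inj₁ eq rewrite eq = acc-u ∷ []
        ... | inj₂ (u-root , eq) rewrite eq =
          All.tabulate λ x∈ → acc-inverse acc-u (>-TF (root⇒NonVar u-root) x∈)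

        mutual
          >-wellFounded : WellFounded (flip _>_)
          >-wellFounded (var _) = acc (⊥-elim ∘ var-minimal)
          >-wellFounded (fun f ts) = Acc-by-root (inj₁ f) (≻-wf _) _ refl (All-Acc-toList ts)
          >-wellFounded (ac f u v) = Acc-by-root (inj₂ f) (≻-wf _) _ refl
            (All.++⁺ (Acc-TFf f (>-wellFounded u)) (Acc-TFf f (>-wellFounded v)))

          All-Acc-toList : ∀ {n} (ts : Vec Tm n) → All Acc> (toList ts)
          All-Acc-toList Vec.[] = []
          All-Acc-toList (t Vec.∷ ts) = >-wellFounded t ∷ All-Acc-toList ts

        >-irrefl : ∀ {s} → ¬ s > s
        >-irrefl s>s = wf⇒asym >-wellFounded s>s s>s

      module Contexts (≻-ac-minimal : ACMinimal N arity k _≻_) where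

        TFf-mono : ∀ f {s t} → s > t → MulExt _>_ (TFf′ f s) (TFf′ f t)
        TFf-mono f {s} s>t with TFf-cases f s
        ... | inj₁ eq rewrite eq = Dominates⇒MulExt (λ ()) (All.map here (>-TFf f s>t))
        TFf-mono f {ac .f u v} s>t | inj₂ (refl , eq) rewrite eq = rooted s>t
          where
          rooted : ∀ {t} → ac f u v > t → MulExt _>_ (TF′ (ac f u v)) (TFf′ f t)
          rooted (acmpo2 refl _ f≻g _) = ⊥-elim (≻-ac-minimal f _ f≻g)
          rooted {t} (acmpo3 S₁ S₂ T₁ T₂ _ r p q rs ne dom) rewrite TFf-of-rooted f t (sym r) =
            mulExt S₁ S₂ T₁ T₂ p q rs ne dom
          rooted (acmpo1 _ m (inj₁ s′>t)) =
            Dominates⇒MulExt (∈⇒≢[] m) (All.map (lose m) (>-TFf f s′>t))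
          rooted {t} (acmpo1 _ m (inj₂ s′≈t))
            rewrite TFf-unrooted f t (∈-TF⇒unrooted {f} {u} {v} m ∘ ≡-trans (root-resp-≈ s′≈t))
            with rest , p ← ∈⇒↭∷ m =
            mulExt [ _ ] rest [ t ] [] p ↭-refl (s′≈t ∷ []) (TF-ac-↭∷⇒≢[] {f} {u} {v} p) []

        ac-monoˡ : ∀ f u {s t} → s > t → ac f s u > ac f t u
        ac-monoˡ f u s>t = MulExt⇒> tt refl
          (MulExt-resp-↭ (++-comm (TFf′ f u) _) (++-comm (TFf′ f u) _)
            (MulExt-++ˡ (TFf′ f u) (TFf-mono f s>t)))

        ac-monoʳ : ∀ f u {s t} → s > t → ac f u s > ac f u t
        ac-monoʳ f u s>t = MulExt⇒> tt refl (MulExt-++ˡ (TFf′ f u) (TFf-mono f s>t))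

        fun-mono : ∀ f ts i {s t} → s > t → fun f (ts [ i ]≔ s) > fun f (ts [ i ]≔ t)
        fun-mono f ts i {s} {t} s>t with A , B , eq ← toList-[]≔ ts i =
          MulExt⇒> tt refl (MulExt-resp-↭ (around s) (around t)
            (MulExt-++ˡ (A ++ B) (Dominates⇒MulExt (λ ()) (here s>t ∷ []))))
          where
          around : ∀ x → (A ++ B) ++ [ x ] ↭ toList (ts [ i ]≔ x)
          around x rewrite eq x = ↭-sym (↭-trans (shift x A B) (++-comm [ x ] (A ++ B)))

        >-closedUnderContexts : ∀ C {s t} → s > t → _⟦_⟧ N arity k C s > _⟦_⟧ N arity k C t
        >-closedUnderContexts □ s>t = s>t
        >-closedUnderContexts (funC f ts i C) s>t = fun-mono f ts i (>-closedUnderContexts C s>t)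
        >-closedUnderContexts (acL f C u) s>t = ac-monoˡ f u (>-closedUnderContexts C s>t)
        >-closedUnderContexts (acR f u C) s>t = ac-monoʳ f u (>-closedUnderContexts C s>t)

      module Substitution (σ : Subst N arity k) where

        inst : Tm → Tm
        inst t = _⟨_⟩ N arity k t σ

        mutual
          inst-resp-≈ : ∀ {s t} → s ≈ t → inst s ≈ inst t
          inst-resp-≈ ac-refl = ac-refl
          inst-resp-≈ (ac-sym p) = ac-sym (inst-resp-≈ p)
          inst-resp-≈ (ac-trans p q) = ac-trans (inst-resp-≈ p) (inst-resp-≈ q)
          inst-resp-≈ (ac-cong-fun f ps) = ac-cong-fun f (substs-resp-≈ ps)
          inst-resp-≈ (ac-cong-ac f p q) = ac-cong-ac f (inst-resp-≈ p) (inst-resp-≈ q)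
          inst-resp-≈ (ac-assoc f x y z) = ac-assoc f (inst x) (inst y) (inst z)
          inst-resp-≈ (ac-comm f x y) = ac-comm f (inst x) (inst y)

          substs-resp-≈ : ∀ {n} {ts us : Vec Tm n} → VecPointwise.Pointwise _≈_ ts us →
            VecPointwise.Pointwise _≈_ (substs N arity k ts σ) (substs N arity k us σ)
          substs-resp-≈ VecPointwise.[] = VecPointwise.[]
          substs-resp-≈ (p VecPointwise.∷ ps) = inst-resp-≈ p VecPointwise.∷ substs-resp-≈ ps

        -- The contribution of an argument w of a term with root r to the flattened
        -- arguments of its instance: an argument of an f-rooted term may become
        -- f-rooted under σ and is then flattened further.
        flatten : ℕ ⊎ Symbol → Tm → List Tm
        flatten (inj₂ (inj₂ f)) w = TFf′ f (inst w)
        flatten _ w = [ inst w ]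

        TFf-inst : ∀ f u → TFf′ f (inst u) ≡ concatMap (flatten (inj₂ (inj₂ f))) (TFf′ f u)
        TFf-inst f (var _) = sym (List.++-identityʳ _)
        TFf-inst f (fun _ _) = refl
        TFf-inst f (ac g a b) with f ≟ g
        ... | yes refl rewrite TFf-inst f a | TFf-inst f b =
          sym (concatMap-++ (flatten (inj₂ (inj₂ f))) (TFf′ f a) (TFf′ f b))
        ... | no f≢g = sym (≡-trans (List.++-identityʳ _) (TFf-other (inst a) (inst b) f≢g))

        toList-substs : ∀ {n} (ts : Vec Tm n) →
          toList (substs N arity k ts σ) ≡ concatMap (λ w → [ inst w ]) (toList ts)
        toList-substs Vec.[] = refl
        toList-substs (t Vec.∷ ts) = cong (inst t ∷_) (toList-substs ts)

        TF-inst : ∀ s → NonVar′ s → TF′ (inst s) ≡ concatMap (flatten (root′ s)) (TF′ s)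
        TF-inst (fun f ts) _ = toList-substs ts
        TF-inst (ac f a b) _ rewrite TFf-inst f a | TFf-inst f b =
          sym (concatMap-++ (flatten (inj₂ (inj₂ f))) (TFf′ f a) (TFf′ f b))

        root-inst : ∀ s → NonVar′ s → root′ (inst s) ≡ root′ s
        root-inst (fun _ _) _ = refl
        root-inst (ac _ _ _) _ = refl

        NonVar-inst : ∀ s → NonVar′ s → NonVar′ (inst s)
        NonVar-inst (fun _ _) _ = tt
        NonVar-inst (ac _ _ _) _ = tt

        >-flatten : ∀ r w {x e} → x > inst w → e ∈ flatten r w → x > e
        >-flatten (inj₁ _) w x>w (here refl) = x>w
        >-flatten (inj₂ (inj₁ _)) w x>w (here refl) = x>w
        >-flatten (inj₂ (inj₂ f)) w x>w e∈ with TFf-cases f (inst w)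
        ... | inj₁ eq with here refl ← subst (_ ∈_) eq e∈ = x>w
        ... | inj₂ (w-root , eq) = >-trans x>w (>-TF (root⇒NonVar w-root) (subst (_ ∈_) eq e∈))

        flatten-≢[] : ∀ r w → flatten r w ≢ []
        flatten-≢[] (inj₁ _) w ()
        flatten-≢[] (inj₂ (inj₁ _)) w ()
        flatten-≢[] (inj₂ (inj₂ f)) w = TFf-≢[] f (inst w)

        flatten-resp-≈ : ∀ r {w w′} → w ≈ w′ → flatten r w ≋ flatten r w′
        flatten-resp-≈ (inj₁ _) e = _ , ↭-refl , inst-resp-≈ e ∷ []
        flatten-resp-≈ (inj₂ (inj₁ _)) e = _ , ↭-refl , inst-resp-≈ e ∷ []
        flatten-resp-≈ (inj₂ (inj₂ f)) e = TFf-resp-≈ f (inst-resp-≈ e)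

        flatten-NonVar : ∀ s {w} → w ∈ TF′ s → NonVar′ w → flatten (root′ s) w ≡ [ inst w ]
        flatten-NonVar (fun _ _) _ _ = refl
        flatten-NonVar (ac f a b) {w} w∈ nv =
          TFf-unrooted f (inst w) (∈-TF⇒unrooted {f} {a} {b} w∈ ∘ ≡-trans (sym (root-inst w nv)))

        ∈-TF-inst : ∀ {s w e} → NonVar′ s → w ∈ TF′ s → e ∈ flatten (root′ s) w → e ∈ TF′ (inst s)
        ∈-TF-inst {s} nv w∈ e∈ =
          subst (_ ∈_) (sym (TF-inst s nv)) (∈-concatMap⁺ (flatten (root′ s)) (lose w∈ e∈))

        inst-TF : ∀ {s w} → NonVar′ s → w ∈ TF′ s → inst s > inst w
        inst-TF {s@(fun _ _)} nv w∈ = >-TF tt (∈-TF-inst {s} nv w∈ (here refl))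
        inst-TF {ac f a b} {w} nv w∈ with TFf-cases f (inst w)
        ... | inj₁ eq =
          >-TF tt (∈-TF-inst {ac f a b} nv w∈ (subst (inst w ∈_) (sym eq) (here refl)))
        ... | inj₂ (w-root , eq) with rest , p ← ∈⇒↭∷ w∈ =
          >-⊂ tt (sym w-root) TF↭
            (concatMap-≢[] F (flatten-≢[] (inj₂ (inj₂ f))) (TF-ac-↭∷⇒≢[] {f} {a} {b} p))
          where
          F : Tm → List Tm
          F = flatten (inj₂ (inj₂ f))
          TF↭ : TF′ (inst (ac f a b)) ↭ TF′ (inst w) ++ concatMap F rest
          TF↭ = subst (_↭ TF′ (inst w) ++ concatMap F rest) (sym (TF-inst (ac f a b) tt))
            (↭-trans (concatMap-↭ F p) (↭-reflexive (cong (_++ concatMap F rest) eq)))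

        All-flatten : ∀ r {x ws} → All (λ w → x > inst w) ws → All (x >_) (concatMap (flatten r) ws)
        All-flatten r {x} {ws} x>ws = All.tabulate λ e∈ →
          let w , w∈ , e∈w = find (∈-concatMap⁻ (flatten r) {xs = ws} e∈) in
          >-flatten r w (All.lookup x>ws w∈) e∈w

        _>ⁱ_ : Tm → Tm → Set
        s >ⁱ t = s > t × inst s > inst t

        MulExt-flatten : ∀ s → NonVar′ s → ∀ {T} → MulExt _>ⁱ_ (TF′ s) T →
          MulExt _>_ (concatMap (flatten (root′ s)) (TF′ s)) (concatMap (flatten (root′ s)) T)
        MulExt-flatten s nv (mulExt S₁ S₂ T₁ T₂ p q rs ne dom)
          with Z , Z↭ , Z≈ ← concatMap-≋ (flatten (root′ s)) (flatten-resp-≈ (root′ s)) rs =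
          mulExt Z (concatMap F S₂) (concatMap F T₁) (concatMap F T₂)
            (↭-trans (concatMap-↭ F p) (↭-trans (↭-reflexive (concatMap-++ F S₁ S₂)) (++⁺ʳ _ Z↭)))
            (↭-trans (concatMap-↭ F q) (↭-reflexive (concatMap-++ F T₁ T₂)))
            Z≈ (concatMap-≢[] F (flatten-≢[] (root′ s)) ne) (All.tabulate below)
          where
          F : Tm → List Tm
          F = flatten (root′ s)
          below : ∀ {e} → e ∈ concatMap F T₂ → Any (_> e) (concatMap F S₂)
          below e∈ with w , w∈ , e∈w ← find (∈-concatMap⁻ F {xs = T₂} e∈)
                   with x , x∈ , (x>w , ix>iw) ← find (All.lookup dom w∈) =
            lose (∈-concatMap⁺ F {xs = S₂} (lose x∈ (subst (inst x ∈_)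
                   (sym (flatten-NonVar s (∈-resp-↭ (↭-sym p) (∈-++⁺ʳ S₁ x∈)) (>⇒NonVar x>w)))
                   (here refl))))
              (>-flatten (root′ s) w ix>iw e∈w)

        mutual
          inst-mono : ∀ {s t} → s > t → inst s > inst t
          inst-mono (acmpo1 nv m (inj₁ d)) = >-trans (inst-TF nv m) (inst-mono d)
          inst-mono (acmpo1 nv m (inj₂ e)) = >-respʳ-≈ (inst-TF nv m) (inst-resp-≈ e)
          inst-mono {s} {t} (acmpo2 rs rt f≻g s>TFt) =
            acmpo2 (≡-trans (root-inst s (root⇒NonVar rs)) rs)
                   (≡-trans (root-inst t (root⇒NonVar rt)) rt) f≻g
              (subst (All (inst s >_)) (sym (TF-inst t (root⇒NonVar rt)))
                (All-flatten (root′ t) (All-inst-mono s>TFt)))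
          inst-mono {s} {t} (acmpo3 S₁ S₂ T₁ T₂ nv r p q rs ne dom) =
            MulExt⇒> (NonVar-inst s nv)
              (≡-trans (root-inst s nv) (≡-trans r (sym (root-inst t nvt))))
              (subst₂ (MulExt _>_) (sym (TF-inst s nv)) (sym TF-inst-t)
                (MulExt-flatten s nv (mulExt S₁ S₂ T₁ T₂ p q rs ne (Dominates-inst dom))))
            where
            nvt : NonVar′ t
            nvt = NonVar-resp-root r nv
            TF-inst-t : TF′ (inst t) ≡ concatMap (flatten (root′ s)) (TF′ t)
            TF-inst-t =
              ≡-trans (TF-inst t nvt) (cong (λ r′ → concatMap (flatten r′) (TF′ t)) (sym r))

          All-inst-mono : ∀ {s xs} → All (s >_) xs → All (λ x → inst s > inst x) xs
          All-inst-mono [] = []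
          All-inst-mono (d ∷ ds) = inst-mono d ∷ All-inst-mono ds

          Dominates-inst : ∀ {S T} → Dominates _>_ S T → Dominates _>ⁱ_ S T
          Dominates-inst [] = []
          Dominates-inst (S>t ∷ dom) = Any-inst S>t ∷ Dominates-inst dom

          Any-inst : ∀ {S t} → Any (_> t) S → Any (_>ⁱ t) S
          Any-inst (here d) = here (d , inst-mono d)
          Any-inst (there S>t) = there (Any-inst S>t)

theorem5p5 : (N : Set) (arity : N → ℕ) (k : ℕ)
    → (_>_ : Sym N arity k → Sym N arity k → Set)
    → IsStrictPartialOrder _≡_ _>_
    → WellFounded (flip _>_)
    → ACMinimal N arity k _>_
    → IsReductionOrder N arity k (_>acmpo_ N arity k _>_)
      × ACCompatible N arity k (_>acmpo_ N arity k _>_)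
theorem5p5 N arity k _≻_ ≻-isStrictPartialOrder ≻-wellFounded ≻-ac-minimal =
  record
    { isStrictPartialOrder = record
        { isEquivalence = isEquivalence
        ; irrefl = λ { refl → >-irrefl }
        ; trans = >-trans
        ; <-resp-≈ = resp₂ _>_
        }
    ; wellFounded = >-wellFounded
    ; closedUnderContexts = >-closedUnderContexts
    ; closedUnderSubst = λ σ → Substitution.inst-mono σ
    }
  , >-AC-compatible
  where
  open ACMPO N arity k
  open Order _≻_
  open Transitivity (IsStrictPartialOrder.trans ≻-isStrictPartialOrder)
  open WellFoundedness ≻-wellFounded
  open Contexts ≻-ac-minimal
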